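{- Let $G$ be a graph and $A\subseteq V(G)$, and assume that for every 3-connected component $C$ of $G$, the treewidth of $C[A\cap V(C)]$ is at most $w$. Then the treewidth of $G[A]$ is at most $\max(w,2)$.
   Context: A tree decomposition of $G$ is a pair $(T,\beta)$ with $T$ a tree and $\beta\colon V(T)\to 2^{V(G)}$ such that each vertex lies in a nonempty connected set of bags and each edge has both endpoints in some bag; its width is $\max_t|\beta(t)|-1$, and treewidth is the minimum width. Adhesions are the sets $\beta(s)\cap\beta(t)$ for $st\in E(T)$. The torso of $\beta(t)$ is $G[\beta(t)]$ with every adhesion $\beta(s)\cap\beta(t)$, $st\in E(T)$, turned into a clique. The 3-connected components of $G$ are defined via the (Tutte / Hopcroft–Tarjan) decomposition: a tree decomposition $(T,\beta)$ of $G$ whose every adhesion has size at most 2 and whose every torso is either 3-connected, a cycle, or has at most 2 vertices (with isomorphism-invariant family of bags); the 3-connected components of $G$ are the torsos of this decomposition that are 3-connected. For a component $C$, $C[X]$ denotes the subgraph of $C$ induced by $X$. -}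

module Defs where

open import Data.Nat using (ℕ; zero; suc; _+_; _≤_)
open import Data.Nat.DivMod using (_%_; m%n<n)
open import Data.Fin using (Fin; toℕ; fromℕ<)
open import Data.Fin.Subset using (Subset; _∈_; _⊆_; _∩_; _─_; ∣_∣)
open import Data.Fin.Permutation using (Permutation′; _⟨$⟩ʳ_)
open import Data.Product using (Σ; ∃; _×_)
open import Data.Sum using (_⊎_)
open import Function.Bundles using (_⇔_)
open import Function.Definitions using (Injective)
open import Relation.Binary.PropositionalEquality using (_≡_; _≢_)
open import Relation.Nullary using (¬_)

-- A graph with vertices drawn from Fin n is a
-- vertex set V ⊆ Fin n together with a relation E; its adjacency is the
-- loop-free symmetric closure of E restricted to V.  (Every finite simple
-- graph is of this form, and every such record denotes a simple graph.)

record Graph (n : ℕ) : Set₁ where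
  field
    V : Subset n
    E : Fin n → Fin n → Set
open Graph public

Adj : ∀ {n} → Graph n → Fin n → Fin n → Set
Adj G u v = u ≢ v × u ∈ V G × v ∈ V G × (E G u v ⊎ E G v u)

_[_] : ∀ {n} → Graph n → Subset n → Graph n
G [ A ] = record { V = V G ∩ A ; E = E G }

_minus_ : ∀ {n} → Graph n → Subset n → Graph n
G minus X = record { V = V G ─ X ; E = E G }

data Walk {n} (G : Graph n) (P : Fin n → Set) : Fin n → Fin n → Set where
  [] : ∀ {u} → P u → Walk G P u u
  step : ∀ {u w v} → P u → Adj G u w → Walk G P w v → Walk G P u v

ConnectedSet : ∀ {n} → Graph n → (Fin n → Set) → Set
ConnectedSet G P = ∀ {u v} → P u → P v → Walk G P u v

Connected : ∀ {n} → Graph n → Set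
Connected G = ConnectedSet G (λ u → u ∈ V G)

next : ∀ {k} → Fin (suc k) → Fin (suc k)
next {k} i = fromℕ< (m%n<n (suc (toℕ i)) (suc k))

HasCycle : ∀ {n} → Graph n → Set
HasCycle {n} G = Σ ℕ λ k → Σ (Fin (3 + k) → Fin n) λ f →
  Injective _≡_ _≡_ f × (∀ i → Adj G (f i) (f (next i)))

IsCycleGraph : ∀ {n} → Graph n → Set
IsCycleGraph {n} G = Σ ℕ λ k → Σ (Fin (3 + k) → Fin n) λ f →
  Injective _≡_ _≡_ f × (∀ i → f i ∈ V G) × (∀ v → v ∈ V G → ∃ λ i → f i ≡ v)
  × (∀ i j → Adj G (f i) (f j) ⇔ (j ≡ next i ⊎ i ≡ next j))

ThreeConnected : ∀ {n} → Graph n → Set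
ThreeConnected {n} G = 4 ≤ ∣ V G ∣ × (∀ (X : Subset n) → ∣ X ∣ ≤ 2 → Connected (G minus X))

IsTree : ∀ {m} → Graph m → Set
IsTree T = (∀ t → t ∈ V T) × Connected T × ¬ HasCycle T

record TreeDecomp {n} (G : Graph n) : Set₁ where
  field
    m : ℕ
    T : Graph (suc m)
    tree : IsTree T
    bag : Fin (suc m) → Subset n
    bag⊆V : ∀ t → bag t ⊆ V G
    vertexCover : ∀ v → v ∈ V G → ∃ λ t → v ∈ bag t
    vertexConnected : ∀ v → v ∈ V G → ConnectedSet T (λ t → v ∈ bag t)
    edgeCover : ∀ u v → Adj G u v → ∃ λ t → u ∈ bag t × v ∈ bag t
open TreeDecomp public

TWAtMost : ∀ {n} → Graph n → ℕ → Set₁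
TWAtMost G k = Σ (TreeDecomp G) λ D → ∀ t → ∣ bag D t ∣ ≤ suc k

-- torso of bag t: G[β(t)] with every adhesion β(s) ∩ β(t), st ∈ E(T), made a clique
torso : ∀ {n} (G : Graph n) (D : TreeDecomp G) → Fin (suc (m D)) → Graph n
torso G D t = record
  { V = bag D t
  ; E = λ u v → E G u v ⊎ (∃ λ s → Adj (T D) t s × u ∈ bag D s × v ∈ bag D s) }

IsAutomorphism : ∀ {n} → Graph n → Permutation′ n → Set
IsAutomorphism G π = (∀ v → (v ∈ V G) ⇔ ((π ⟨$⟩ʳ v) ∈ V G))
  × (∀ u v → Adj G u v ⇔ Adj G (π ⟨$⟩ʳ u) (π ⟨$⟩ʳ v))

-- decomposition of G into 3-connected components, cycles and ≤2-vertex
-- parts (Tutte / Hopcroft–Tarjan type): adhesions of size ≤ 2, torsos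
-- 3-connected, cycles or of size ≤ 2, family of bags invariant under Aut(G)
IsTutteDecomp : ∀ {n} (G : Graph n) → TreeDecomp G → Set
IsTutteDecomp {n} G D =
  (∀ s t → Adj (T D) s t → ∣ bag D s ∩ bag D t ∣ ≤ 2)
  × (∀ t → ThreeConnected (torso G D t) ⊎ IsCycleGraph (torso G D t) ⊎ ∣ bag D t ∣ ≤ 2)
  × (∀ (π : Permutation′ n) → IsAutomorphism G π →
       ∀ t → ∃ λ t′ → ∀ v → (v ∈ bag D t) ⇔ ((π ⟨$⟩ʳ v) ∈ bag D t′))

module Submission where

-- The part in A of every torso of D has a tree decomposition of width at most max(w, 2):
-- by hypothesis for 3-connected torsos, by a fan triangulation for cycles, and by a single
-- bag for torsos with at most two vertices. An adhesion has at most two vertices and is a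
-- clique in both torsos containing it, so its part in A lies in a bag of each of the two
-- decompositions. Joining these two bags for every edge of the tree of D glues the
-- decompositions into one of G[A] without enlarging any bag; once D and every block are
-- rooted, the glued tree is given by parent pointers along which a lexicographic rank decreases.

open import Defs
open import Data.Nat using (ℕ; zero; suc; _+_; _*_; _≤_; _<_; _⊔_; z≤n; s≤s)
import Data.Nat.Properties as ℕ
open import Data.Nat.DivMod using (_%_; m<n⇒m%n≡m; n%n≡0)
open import Data.Fin as Fin using (Fin; toℕ; fromℕ; fromℕ<; inject₁)
import Data.Fin.Properties as Fin
open import Data.Fin.Subset using (Subset; _∈_; _∉_; _⊆_; _∩_; _∪_; _─_; _-_; ⁅_⁆; ∣_∣; ⊤; ⊥)
open import Data.Fin.Subset.Properties
open import Data.List using (List; []; _∷_; _++_; length; lookup; allFin; head)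
open import Data.Maybe using (fromMaybe)
open import Data.List.Extrema.Nat using (argmax; f[xs]≤f[argmax])
import Data.List.Relation.Unary.All as All
open import Data.List.Membership.Propositional using () renaming (_∈_ to _∈ˡ_; _∉_ to _∉ˡ_)
open import Data.List.Membership.Propositional.Properties using (∈-allFin; ∈-lookup; ∈-++⁻)
open import Data.List.Relation.Binary.Subset.Propositional using () renaming (_⊆_ to _⊆ˡ_)
open import Data.List.Relation.Unary.Any using (here; there)
open import Data.Vec using ([]; _∷_; here; there)
open import Data.Bool using (true; false)
open import Data.Product using (Σ; ∃; _×_; _,_; proj₁; proj₂; uncurry)
open import Data.Sum using (_⊎_; inj₁; inj₂; [_,_])
import Data.Sum as Sum
open import Data.Empty using (⊥-elim)
open import Function using (_∘_; id; case_of_)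
open import Function.Bundles using (Equivalence)
open import Induction.WellFounded using (Acc; acc)
open import Data.Nat.Induction using (<-wellFounded)
open import Relation.Binary.PropositionalEquality hiding ([_])
open import Relation.Nullary using (¬_; yes; no; contradiction)

Adj-sym : ∀ {n} {G : Graph n} {u v} → Adj G u v → Adj G v u
Adj-sym (u≢v , u∈V , v∈V , e) = u≢v ∘ sym , v∈V , u∈V , Sum.swap e

module _ {n} {G : Graph n} {P : Fin n → Set} where

  walk-source : ∀ {u v} → Walk G P u v → P u
  walk-source ([] p) = p
  walk-source (step p _ _) = p

  _++ʷ_ : ∀ {u v w} → Walk G P u v → Walk G P v w → Walk G P u w
  [] _ ++ʷ q = q
  step p a w ++ʷ q = step p a (w ++ʷ q)

  reverseʷ : ∀ {u v} → Walk G P u v → Walk G P v u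
  reverseʷ ([] p) = [] p
  reverseʷ (step p a w) = reverseʷ w ++ʷ step (walk-source w) (Adj-sym {G = G} a) ([] p)

mapʷ : ∀ {n n′} {G : Graph n} {H : Graph n′} {P : Fin n → Set} {Q : Fin n′ → Set}
  (f : Fin n → Fin n′) → (∀ {x} → P x → Q (f x)) → (∀ {x y} → Adj G x y → Adj H (f x) (f y)) →
  ∀ {u v} → Walk G P u v → Walk H Q (f u) (f v)
mapʷ f P⇒Q adj ([] p) = [] (P⇒Q p)
mapʷ f P⇒Q adj (step p a w) = step (P⇒Q p) (adj a) (mapʷ f P⇒Q adj w)

toℕ-next : ∀ {k} (i : Fin (suc k)) →
  (toℕ i < k × toℕ (next i) ≡ suc (toℕ i)) ⊎ (toℕ i ≡ k × toℕ (next i) ≡ 0)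
toℕ-next {k} i with suc (toℕ i) ℕ.<? suc k
... | yes i+1<k+1 = inj₁ (ℕ.≤-pred i+1<k+1 , trans (Fin.toℕ-fromℕ< _) (m<n⇒m%n≡m i+1<k+1))
... | no i+1≮k+1 = inj₂ (i≡k , trans (Fin.toℕ-fromℕ< _) (trans (cong (λ x → suc x % suc k) i≡k) (n%n≡0 (suc k))))
  where
  i≡k : toℕ i ≡ k
  i≡k = ℕ.≤-antisym (ℕ.≤-pred (Fin.toℕ<n i)) (ℕ.≤-pred (ℕ.≮⇒≥ i+1≮k+1))

next-surjective : ∀ {k} (i : Fin (suc k)) → ∃ λ j → next j ≡ i
next-surjective {k} Fin.zero with toℕ-next (fromℕ k)
... | inj₁ (k<k , _) = contradiction (subst (_< k) (Fin.toℕ-fromℕ k) k<k) (ℕ.<-irrefl refl)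
... | inj₂ (_ , wrap) = fromℕ k , Fin.toℕ-injective wrap
next-surjective {suc k} (Fin.suc i) with toℕ-next (inject₁ i)
... | inj₁ (_ , succ) = inject₁ i , Fin.toℕ-injective (trans succ (cong suc (Fin.toℕ-inject₁ i)))
... | inj₂ (i≡k , _) = contradiction (trans (sym (Fin.toℕ-inject₁ i)) i≡k) (ℕ.<⇒≢ (Fin.toℕ<n i))

next∘next≢id : ∀ {k} (i : Fin (3 + k)) → next (next i) ≢ i
next∘next≢id i nni≡i with toℕ-next i | toℕ-next (next i) | cong toℕ nni≡i
... | inj₁ (_ , ni) | inj₁ (_ , nni) | eq = ℕ.m≢1+n+m (toℕ i) (trans (sym eq) (trans nni (cong suc ni)))
... | inj₁ (_ , ni) | inj₂ (ni≡last , nni) | eq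
  rewrite trans (sym eq) nni = ℕ.0≢1+n (ℕ.suc-injective (trans (sym ni) ni≡last))
... | inj₂ (i≡last , ni) | inj₁ (_ , nni) | eq
  rewrite ni = ℕ.0≢1+n (ℕ.suc-injective (trans (sym nni) (trans eq i≡last)))
... | inj₂ (_ , ni) | inj₂ (ni≡last , _) | _ = ℕ.0≢1+n (trans (sym ni) ni≡last)

argmaxᶠ : ∀ {n} → (Fin (suc n) → ℕ) → Fin (suc n)
argmaxᶠ f = argmax f Fin.zero (allFin _)

f≤f[argmaxᶠ] : ∀ {n} (f : Fin (suc n) → ℕ) i → f i ≤ f (argmaxᶠ f)
f≤f[argmaxᶠ] f i = All.lookup (f[xs]≤f[argmax] {f = f} Fin.zero (allFin _)) (∈-allFin i)

maxᶠ : ∀ {n} → (Fin (suc n) → ℕ) → ℕ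
maxᶠ f = f (argmaxᶠ f)

f≤maxᶠ : ∀ {n} (f : Fin (suc n) → ℕ) i → f i ≤ maxᶠ f
f≤maxᶠ = f≤f[argmaxᶠ]

*+-<-lex : ∀ {a b i j B} → a < b → i < B → a * B + i < b * B + j
*+-<-lex {a} {b} {i} {j} {B} a<b i<B = begin-strict
  a * B + i   <⟨ ℕ.+-monoʳ-< (a * B) i<B ⟩
  a * B + B   ≡⟨ ℕ.+-comm (a * B) B ⟩
  suc a * B   ≤⟨ ℕ.*-monoˡ-≤ B a<b ⟩
  b * B       ≤⟨ ℕ.m≤m+n (b * B) j ⟩
  b * B + j   ∎
  where open ℕ.≤-Reasoning

-- Trees given by parent pointers

parentGraph : ∀ {M} → (Fin (suc M) → Fin (suc M)) → Graph (suc M)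
parentGraph parent = record { V = ⊤ ; E = λ a b → b ≡ parent a }

parentGraph-adj : ∀ {M} (parent : Fin (suc M) → Fin (suc M)) {a b} →
  a ≢ b → b ≡ parent a → Adj (parentGraph parent) a b
parentGraph-adj _ a≢b b≡parent = a≢b , ∈⊤ , ∈⊤ , inj₁ b≡parent

record ParentPointers (M : ℕ) : Set where
  field
    parent : Fin (suc M) → Fin (suc M)
    root : Fin (suc M)
    rank : Fin (suc M) → ℕ
    parent-root : parent root ≡ root
    rank-parent : ∀ a → a ≢ root → rank (parent a) < rank a

module _ {M} (P : ParentPointers M) where
  open ParentPointers P

  private
    T′ : Graph (suc M)
    T′ = parentGraph parent

    adj-parent : ∀ a → a ≢ root → Adj T′ a (parent a)
    adj-parent a a≢root = parentGraph-adj parent (λ a≡p → ℕ.<-irrefl (cong rank (sym a≡p)) (rank-parent a a≢root)) refl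

    walk-to-root : ∀ a → Acc _<_ (rank a) → Walk T′ (_∈ ⊤) a root
    walk-to-root a (acc smaller) with a Fin.≟ root
    ... | yes refl = [] ∈⊤
    ... | no a≢root = step ∈⊤ (adj-parent a a≢root) (walk-to-root (parent a) (smaller (rank-parent a a≢root)))

    toward-parent : ∀ {x y} → Adj T′ x y → rank y ≤ rank x → y ≡ parent x
    toward-parent (_ , _ , _ , inj₁ y≡parent) _ = y≡parent
    toward-parent {x} {y} (x≢y , _ , _ , inj₂ x≡parent) y≤x with y Fin.≟ root
    ... | yes refl = contradiction (trans x≡parent parent-root) x≢y
    ... | no y≢root = contradiction y≤x (ℕ.<⇒≱ (subst (λ z → rank z < rank y) (sym x≡parent) (rank-parent y y≢root)))

    -- Both cycle neighbours of a vertex of maximal rank would be its parent.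
    acyclic : ¬ HasCycle T′
    acyclic (k , f , f-inj , f-adj) = no-maximum (argmaxᶠ (rank ∘ f)) (f≤f[argmaxᶠ] (rank ∘ f))
      where
      no-maximum : ∀ i → ¬ (∀ j → rank (f j) ≤ rank (f i))
      no-maximum i maximal with next-surjective i
      ... | j , next-j≡i = next∘next≢id i (trans (cong next (sym j≡next-i)) next-j≡i)
        where
        j≡next-i : j ≡ next i
        j≡next-i = f-inj (trans (toward-parent (Adj-sym {G = T′} (subst (λ x → Adj T′ (f j) (f x)) next-j≡i (f-adj j))) (maximal j))
                                (sym (toward-parent (f-adj i) (maximal (next i)))))

  parentGraph-isTree : IsTree (parentGraph parent)
  parentGraph-isTree = (λ _ → ∈⊤) , (λ {u} {v} _ _ → to-root u ++ʷ reverseʷ (to-root v)) , acyclic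
    where
    to-root : ∀ a → Walk T′ (_∈ ⊤) a root
    to-root a = walk-to-root a (<-wellFounded (rank a))

-- Simple paths

module Paths {n} (G : Graph n) where
  open import Data.List.Membership.DecPropositional (Fin._≟_ {n}) using () renaming (_∈?_ to _∈ˡ?_)

  data Chain : Fin n → List (Fin n) → Set where
    [] : ∀ {x} → Chain x []
    _∷_ : ∀ {x y l} → Adj G x y → Chain y l → Chain x (y ∷ l)

  data Distinct : List (Fin n) → Set where
    [] : Distinct []
    _∷_ : ∀ {x l} → x ∉ˡ l → Distinct l → Distinct (x ∷ l)

  end : Fin n → List (Fin n) → Fin n
  end x [] = x
  end x (y ∷ l) = end y l

  end-∈ : ∀ x l → end x l ∈ˡ x ∷ l
  end-∈ x [] = here refl
  end-∈ x (y ∷ l) = there (end-∈ y l)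

  end-++ : ∀ x l l′ → end x (l ++ l′) ≡ end (end x l) l′
  end-++ x [] l′ = refl
  end-++ x (y ∷ l) l′ = end-++ y l l′

  Chain-++ : ∀ {x l l′} → Chain x l → Chain (end x l) l′ → Chain x (l ++ l′)
  Chain-++ [] c′ = c′
  Chain-++ (x~y ∷ c) c′ = x~y ∷ Chain-++ c c′

  Chain-reverse : ∀ {x l} → Chain x l →
    ∃ λ r → Chain (end x l) r × end (end x l) r ≡ x × r ⊆ˡ x ∷ l
  Chain-reverse [] = [] , [] , refl , λ ()
  Chain-reverse {x} {y ∷ l} (x~y ∷ c) with Chain-reverse c
  ... | r , cr , r-ends , r⊆ = r ++ x ∷ [] , Chain-++ cr (subst (λ z → Chain z (x ∷ [])) (sym r-ends) (Adj-sym {G = G} x~y ∷ [])) ,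
        end-++ (end y l) r (x ∷ []) , r++x⊆
    where
    r++x⊆ : r ++ x ∷ [] ⊆ˡ x ∷ y ∷ l
    r++x⊆ m with ∈-++⁻ r m
    ... | inj₁ m∈r = there (r⊆ m∈r)
    ... | inj₂ (here refl) = here refl

  Chain-of-walk : ∀ {P u v} → Walk G P u v → ∃ λ l → Chain u l × end u l ≡ v
  Chain-of-walk ([] _) = [] , [] , refl
  Chain-of-walk (step _ u~w w) with Chain-of-walk w
  ... | l , c , l-ends = _ ∷ l , u~w ∷ c , l-ends

  record Path (x y : Fin n) : Set where
    constructor path
    field
      tail : List (Fin n)
      chain : Chain x tail
      distinct : Distinct (x ∷ tail)
      ends : end x tail ≡ y
  open Path public

  prepend : ∀ {x y z} → Adj G x y → (p : Path y z) → x ∉ˡ y ∷ tail p → Path x z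
  prepend x~y (path l c d e) x∉ = path (_ ∷ l) (x~y ∷ c) (x∉ ∷ d) e

  suffix : ∀ {x y z} (p : Path x y) → z ∈ˡ tail p →
    Σ (Path z y) λ q → length (tail q) < length (tail p) × tail q ⊆ˡ tail p
  suffix (path (_ ∷ l) (_ ∷ c) (_ ∷ d) e) (here refl) = path l c d e , ℕ.≤-refl , there
  suffix (path (_ ∷ l) (_ ∷ c) (_ ∷ d) e) (there z∈l) with suffix (path l c d e) z∈l
  ... | q , shorter , q⊆ = q , ℕ.m≤n⇒m≤1+n shorter , there ∘ q⊆

  shortcut : ∀ {x l} → Chain x l → Σ (Path x (end x l)) λ p → tail p ⊆ˡ l
  shortcut [] = path [] [] ((λ ()) ∷ []) refl , λ ()
  shortcut {x} (x~y ∷ c) with shortcut c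
  ... | p , p⊆ with x ∈ˡ? _ ∷ tail p
  ...   | no x∉ = prepend x~y p x∉ , λ { (here refl) → here refl ; (there m) → there (p⊆ m) }
  ...   | yes (here x≡y) = contradiction x≡y (proj₁ x~y)
  ...   | yes (there x∈p) = let (q , _ , q⊆) = suffix p x∈p in q , there ∘ p⊆ ∘ q⊆

  toPath : ∀ {P u v} → Walk G P u v → Path u v
  toPath w with Chain-of-walk w
  ... | l , c , refl = proj₁ (shortcut c)

  private
    lookup-injective : ∀ {l} → Distinct l → ∀ i j → lookup l i ≡ lookup l j → i ≡ j
    lookup-injective (_ ∷ _) Fin.zero Fin.zero _ = refl
    lookup-injective (x∉ ∷ _) Fin.zero (Fin.suc j) eq = contradiction (subst (_∈ˡ _) (sym eq) (∈-lookup j)) x∉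
    lookup-injective (x∉ ∷ _) (Fin.suc i) Fin.zero eq = contradiction (subst (_∈ˡ _) eq (∈-lookup i)) x∉
    lookup-injective (_ ∷ d) (Fin.suc i) (Fin.suc j) eq = cong Fin.suc (lookup-injective d i j eq)

    lookup-chain : ∀ {x l} → Chain x l → ∀ (i j : Fin (length (x ∷ l))) → toℕ j ≡ suc (toℕ i) →
      Adj G (lookup (x ∷ l) i) (lookup (x ∷ l) j)
    lookup-chain (x~y ∷ _) Fin.zero (Fin.suc Fin.zero) _ = x~y
    lookup-chain (_ ∷ c) (Fin.suc i) (Fin.suc j) j≡i+1 = lookup-chain c i j (ℕ.suc-injective j≡i+1)
    lookup-chain [] Fin.zero Fin.zero ()
    lookup-chain (_ ∷ _) Fin.zero Fin.zero ()
    lookup-chain (_ ∷ _) Fin.zero (Fin.suc (Fin.suc _)) ()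
    lookup-chain (_ ∷ _) (Fin.suc _) Fin.zero ()

    lookup-last : ∀ x l (i : Fin (length (x ∷ l))) → toℕ i ≡ length l → lookup (x ∷ l) i ≡ end x l
    lookup-last x [] Fin.zero _ = refl
    lookup-last x (y ∷ l) (Fin.suc i) i≡len = lookup-last y l i (ℕ.suc-injective i≡len)

  closedChain⇒cycle : ∀ {x y z l} → Distinct (x ∷ y ∷ z ∷ l) → Chain x (y ∷ z ∷ l) →
    Adj G (end z l) x → HasCycle G
  closedChain⇒cycle {x} {y} {z} {l} d c closing =
    length l , lookup (x ∷ y ∷ z ∷ l) , (λ {i} {j} → lookup-injective d i j) , adjacent
    where
    adjacent : ∀ i → Adj G (lookup (x ∷ y ∷ z ∷ l) i) (lookup (x ∷ y ∷ z ∷ l) (next i))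
    adjacent i with toℕ-next i
    ... | inj₁ (_ , succ) = lookup-chain c i (next i) succ
    ... | inj₂ (i-last , wrap) rewrite Fin.toℕ-injective {i = next i} {j = Fin.zero} wrap =
      subst (λ v → Adj G v x) (sym (lookup-last x (y ∷ z ∷ l) i i-last)) closing

  -- Two distinct simple paths with common ends would close up to a cycle through their start.
  path-unique : ¬ HasCycle G → ∀ {x y} (p q : Path x y) → tail p ≡ tail q
  path-unique acyclic (path l₁ c₁ d₁ e₁) (path l₂ c₂ d₂ e₂) = tails-unique c₁ c₂ d₁ d₂ (trans e₁ (sym e₂))
    where
    tails-unique : ∀ {x l₁ l₂} → Chain x l₁ → Chain x l₂ → Distinct (x ∷ l₁) → Distinct (x ∷ l₂) →
      end x l₁ ≡ end x l₂ → l₁ ≡ l₂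
    tails-unique [] [] _ _ _ = refl
    tails-unique {l₂ = _ ∷ l} [] _ _ (x∉ ∷ _) x≡end = contradiction (subst (_∈ˡ _) (sym x≡end) (end-∈ _ l)) x∉
    tails-unique {l₁ = _ ∷ l} _ [] (x∉ ∷ _) _ end≡x = contradiction (subst (_∈ˡ _) end≡x (end-∈ _ l)) x∉
    tails-unique {l₁ = y₁ ∷ l₁} {y₂ ∷ l₂} (x~y₁ ∷ c₁) (x~y₂ ∷ c₂) (x∉₁ ∷ d₁) (x∉₂ ∷ d₂) same-end
      with y₁ Fin.≟ y₂
    ... | yes refl = cong (y₁ ∷_) (tails-unique c₁ c₂ d₁ d₂ same-end)
    ... | no y₁≢y₂ with Chain-reverse c₂
    ...   | r , cr , r-ends , r⊆ = ⊥-elim (no-detour (shortcut joined))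
      where
      joined : Chain y₁ (l₁ ++ r)
      joined = Chain-++ c₁ (subst (λ v → Chain v r) (sym same-end) cr)
      joined-ends : end y₁ (l₁ ++ r) ≡ y₂
      joined-ends = trans (end-++ y₁ l₁ r) (trans (cong (λ v → end v r) same-end) r-ends)
      no-detour : ¬ Σ (Path y₁ (end y₁ (l₁ ++ r))) (λ p → tail p ⊆ˡ l₁ ++ r)
      no-detour (path [] _ _ y₁≡end , _) = y₁≢y₂ (trans y₁≡end joined-ends)
      no-detour (path (w ∷ R) c d e , R⊆) = acyclic (closedChain⇒cycle (x∉ ∷ d) (x~y₁ ∷ c)
        (subst (λ v → Adj G v _) (sym (trans e joined-ends)) (Adj-sym {G = G} x~y₂)))
        where
        x∉ : _ ∉ˡ y₁ ∷ w ∷ R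
        x∉ (here x≡y₁) = x∉₁ (here x≡y₁)
        x∉ (there x∈R) = Sum.[ x∉₁ ∘ there , x∉₂ ∘ r⊆ ] (∈-++⁻ l₁ (R⊆ x∈R))

-- Rooting a tree

module Rooting {m} (T : Graph (suc m)) (T-tree : IsTree T) (r : Fin (suc m)) where
  open Paths T
  open import Data.List.Membership.DecPropositional (Fin._≟_ {suc m}) using () renaming (_∈?_ to _∈ˡ?_)

  opaque
    pathToRoot : ∀ a → Path a r
    pathToRoot a = toPath (proj₁ (proj₂ T-tree) (proj₁ T-tree a) (proj₁ T-tree r))

  parent : Fin (suc m) → Fin (suc m)
  parent a = fromMaybe a (head (tail (pathToRoot a)))

  rank : Fin (suc m) → ℕ
  rank a = length (tail (pathToRoot a))

  private
    tail-unique : ∀ {a} (p : Path a r) → tail p ≡ tail (pathToRoot a)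
    tail-unique p = path-unique (proj₂ (proj₂ T-tree)) p (pathToRoot _)

    parent-via : ∀ {a y l} (p : Path a r) → tail p ≡ y ∷ l → parent a ≡ y
    parent-via p tail≡ = cong (fromMaybe _ ∘ head) (trans (sym (tail-unique p)) tail≡)

    rank-via : ∀ {a} (p : Path a r) → rank a ≡ length (tail p)
    rank-via p = cong length (sym (tail-unique p))

    step-to-root : ∀ {a} (p : Path a r) → a ≢ r → Adj T a (parent a) × rank (parent a) < rank a
    step-to-root (path [] _ _ a≡r) a≢r = contradiction a≡r a≢r
    step-to-root p@(path (y ∷ l) (a~y ∷ c) (_ ∷ d) e) _
      rewrite parent-via p refl | rank-via p | rank-via (path l c d e) = a~y , ℕ.≤-refl

    closer : ∀ {a b} → a ∈ˡ b ∷ tail (pathToRoot b) → a ≢ b → rank a < rank b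
    closer (here a≡b) a≢b = contradiction a≡b a≢b
    closer {b = b} (there a∈path) _ with suffix (pathToRoot b) a∈path
    ... | q , shorter , _ rewrite rank-via q = shorter

  parent-root : parent r ≡ r
  parent-root = cong (fromMaybe r ∘ head) (sym (tail-unique (path [] [] ((λ ()) ∷ []) refl)))

  parent-adj : ∀ a → a ≢ r → Adj T a (parent a)
  parent-adj a a≢r = proj₁ (step-to-root (pathToRoot a) a≢r)

  rank-parent : ∀ a → a ≢ r → rank (parent a) < rank a
  rank-parent a a≢r = proj₂ (step-to-root (pathToRoot a) a≢r)

  parentPointers : ParentPointers m
  parentPointers = record
    { parent = parent ; root = r ; rank = rank ; parent-root = parent-root ; rank-parent = rank-parent }

  parent-adj⇒≢root : ∀ {a} → Adj T a (parent a) → a ≢ r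
  parent-adj⇒≢root (a≢parent , _) refl = a≢parent (sym parent-root)

  -- If each endpoint lay on the other's path to the root, each would be closer to the root than the other.
  adj⇒parent : ∀ {a b} → Adj T a b → b ≡ parent a ⊎ a ≡ parent b
  adj⇒parent {a} {b} a~b with a ∈ˡ? b ∷ tail (pathToRoot b) | b ∈ˡ? a ∷ tail (pathToRoot a)
  ... | no a∉ | _ = inj₁ (sym (parent-via (prepend a~b (pathToRoot b) a∉) refl))
  ... | yes _ | no b∉ = inj₂ (sym (parent-via (prepend (Adj-sym {G = T} a~b) (pathToRoot a) b∉) refl))
  ... | yes a∈ | yes b∈ = ⊥-elim (ℕ.<-asym (closer a∈ (proj₁ a~b)) (closer b∈ (proj₁ a~b ∘ sym)))

-- Basic tree decompositions

∣p∪q∣≤∣p∣+∣q∣ : ∀ {n} (p q : Subset n) → ∣ p ∪ q ∣ ≤ ∣ p ∣ + ∣ q ∣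
∣p∪q∣≤∣p∣+∣q∣ [] [] = z≤n
∣p∪q∣≤∣p∣+∣q∣ (false ∷ p) (false ∷ q) = ∣p∪q∣≤∣p∣+∣q∣ p q
∣p∪q∣≤∣p∣+∣q∣ (false ∷ p) (true ∷ q) = ℕ.≤-trans (s≤s (∣p∪q∣≤∣p∣+∣q∣ p q)) (ℕ.≤-reflexive (sym (ℕ.+-suc _ _)))
∣p∪q∣≤∣p∣+∣q∣ (true ∷ p) (false ∷ q) = s≤s (∣p∪q∣≤∣p∣+∣q∣ p q)
∣p∪q∣≤∣p∣+∣q∣ (true ∷ p) (true ∷ q) = s≤s (ℕ.≤-trans (∣p∪q∣≤∣p∣+∣q∣ p q) (ℕ.≤-trans (ℕ.n≤1+n _) (ℕ.≤-reflexive (sym (ℕ.+-suc _ _)))))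

x∈p─q⇒x∉q : ∀ {n} {x : Fin n} (p q : Subset n) → x ∈ p ─ q → x ∉ q
x∈p─q⇒x∉q (false ∷ p) (true ∷ q) () here
x∈p─q⇒x∉q (true ∷ p) (true ∷ q) () here
x∈p─q⇒x∉q (_ ∷ p) (_ ∷ q) (there x∈p─q) (there x∈q) = x∈p─q⇒x∉q p q x∈p─q x∈q

TWAtMost-mono : ∀ {n} {H : Graph n} {k k′} → k ≤ k′ → TWAtMost H k → TWAtMost H k′
TWAtMost-mono k≤k′ (D , width) = D , λ t → ℕ.≤-trans (width t) (s≤s k≤k′)

clique-in-bag : ∀ {n} {H : Graph n} (D : TreeDecomp H) (S : Subset n) → ∣ S ∣ ≤ 2 → S ⊆ V H →
  (∀ {u v} → u ∈ S → v ∈ S → u ≢ v → Adj H u v) → ∃ λ t → S ⊆ bag D t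
clique-in-bag D S ∣S∣≤2 S⊆V clique with nonempty? S
... | no S-empty = Fin.zero , λ {x} x∈S → contradiction (x , x∈S) S-empty
... | yes (u , u∈S) with nonempty? (S - u)
...   | no S-u-empty = proj₁ (vertexCover D u (S⊆V u∈S)) , S⊆
  where
  S⊆ : S ⊆ bag D (proj₁ (vertexCover D u (S⊆V u∈S)))
  S⊆ {y} y∈S with y Fin.≟ u
  ... | yes refl = proj₂ (vertexCover D u (S⊆V u∈S))
  ... | no y≢u = contradiction (y , x∈p∧x≢y⇒x∈p-y y∈S y≢u) S-u-empty
...   | yes (v , v∈S-u) = proj₁ uv-bag , S⊆
  where
  v∈S : v ∈ S
  v∈S = p─q⊆p S ⁅ u ⁆ v∈S-u
  v≢u : v ≢ u
  v≢u = x∉⁅y⁆⇒x≢y (x∈p─q⇒x∉q S ⁅ u ⁆ v∈S-u)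
  uv-bag : ∃ λ t → u ∈ bag D t × v ∈ bag D t
  uv-bag = edgeCover D u v (clique u∈S v∈S (v≢u ∘ sym))
  S⊆ : S ⊆ bag D (proj₁ uv-bag)
  S⊆ {y} y∈S with y Fin.≟ u | y Fin.≟ v
  ... | yes refl | _ = proj₁ (proj₂ uv-bag)
  ... | no _ | yes refl = proj₂ (proj₂ uv-bag)
  ... | no y≢u | no y≢v = contradiction ∣S∣≤2 (ℕ.<⇒≱ 3≤∣S∣)
    where
    0<∣S-u-v∣ : 0 < ∣ S - u - v ∣
    0<∣S-u-v∣ = ℕ.≤-<-trans z≤n (x∈p⇒∣p-x∣<∣p∣ (x∈p∧x≢y⇒x∈p-y (x∈p∧x≢y⇒x∈p-y y∈S y≢u) y≢v))
    3≤∣S∣ : 3 ≤ ∣ S ∣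
    3≤∣S∣ = ℕ.≤-trans (s≤s (ℕ.≤-trans (s≤s 0<∣S-u-v∣) (x∈p⇒∣p-x∣<∣p∣ v∈S-u))) (x∈p⇒∣p-x∣<∣p∣ u∈S)

induced-adj : ∀ {n} {H : Graph n} {A : Subset n} {u v} → Adj (H [ A ]) u v → Adj H u v
induced-adj {H = H} {A} (u≢v , u∈ , v∈ , e) = u≢v , proj₁ (x∈p∩q⁻ (V H) A u∈) , proj₁ (x∈p∩q⁻ (V H) A v∈) , e

restrictDecomp : ∀ {n} {H : Graph n} (A : Subset n) → TreeDecomp H → TreeDecomp (H [ A ])
restrictDecomp {H = H} A D = record
  { m = m D ; T = T D ; tree = tree D
  ; bag = λ t → bag D t ∩ A
  ; bag⊆V = λ t v∈ → let (v∈bag , v∈A) = x∈p∩q⁻ (bag D t) A v∈ in x∈p∩q⁺ (bag⊆V D t v∈bag , v∈A)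
  ; vertexCover = λ v v∈ → let (v∈V , v∈A) = x∈p∩q⁻ (V H) A v∈ ; (t , v∈bag) = vertexCover D v v∈V
                           in t , x∈p∩q⁺ (v∈bag , v∈A)
  ; vertexConnected = λ v v∈ {s} {t} v∈s v∈t → let (v∈V , v∈A) = x∈p∩q⁻ (V H) A v∈ in
      mapʷ id (λ v∈bag → x∈p∩q⁺ (v∈bag , v∈A)) id
        (vertexConnected D v v∈V (proj₁ (x∈p∩q⁻ (bag D s) A v∈s)) (proj₁ (x∈p∩q⁻ (bag D t) A v∈t)))
  ; edgeCover = λ u v u~v@(_ , u∈ , v∈ , _) → let (t , u∈bag , v∈bag) = edgeCover D u v (induced-adj {H = H} u~v)
      in t , x∈p∩q⁺ (u∈bag , proj₂ (x∈p∩q⁻ (V H) A u∈)) , x∈p∩q⁺ (v∈bag , proj₂ (x∈p∩q⁻ (V H) A v∈))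
  }

TWAtMost-induced : ∀ {n} {H : Graph n} (A : Subset n) {k} → TWAtMost H k → TWAtMost (H [ A ]) k
TWAtMost-induced A (D , width) = restrictDecomp A D , λ t → ℕ.≤-trans (∣p∩q∣≤∣p∣ (bag D t) A) (width t)

singleBagDecomp : ∀ {n} (H : Graph n) → TreeDecomp H
singleBagDecomp H = record
  { m = 0 ; T = parentGraph id
  ; tree = parentGraph-isTree (record
      { parent = id ; root = Fin.zero ; rank = λ _ → 0 ; parent-root = refl
      ; rank-parent = λ { Fin.zero 0≢0 → contradiction refl 0≢0 ; (Fin.suc ()) _ } })
  ; bag = λ _ → V H
  ; bag⊆V = λ _ → id
  ; vertexCover = λ _ v∈V → Fin.zero , v∈V
  ; vertexConnected = λ { _ _ {Fin.zero} {Fin.zero} v∈V _ → [] v∈V }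
  ; edgeCover = λ _ _ (_ , u∈V , v∈V , _) → Fin.zero , u∈V , v∈V
  }

TWAtMost-small : ∀ {n} (H : Graph n) {k} → ∣ V H ∣ ≤ suc k → TWAtMost H k
TWAtMost-small H ∣V∣≤ = singleBagDecomp H , λ _ → ∣V∣≤

-- Cycles have treewidth at most two

inject₁-or-fromℕ : ∀ {k} (i : Fin (suc k)) → (∃ λ j → inject₁ j ≡ i) ⊎ i ≡ fromℕ k
inject₁-or-fromℕ {zero} Fin.zero = inj₂ refl
inject₁-or-fromℕ {suc k} Fin.zero = inj₁ (Fin.zero , refl)
inject₁-or-fromℕ {suc k} (Fin.suc i) = Sum.map (λ (j , e) → Fin.suc j , cong Fin.suc e) (cong Fin.suc) (inject₁-or-fromℕ i)

-- The fan triangulation of the cycle f 0, f 1, …, f (k+2) from its vertex f 0.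
module Fan {n k} (H : Graph n) (f : Fin (3 + k) → Fin n) (f-inj : ∀ {i j} → f i ≡ f j → i ≡ j)
  (f∈V : ∀ i → f i ∈ V H) where

  second third : Fin (suc k) → Fin (3 + k)
  second j = Fin.suc (inject₁ j)
  third j = Fin.suc (Fin.suc j)

  fanBag : Fin (suc k) → Subset n
  fanBag j = ⁅ f Fin.zero ⁆ ∪ (⁅ f (second j) ⁆ ∪ ⁅ f (third j) ⁆)

  first∈ : ∀ j → f Fin.zero ∈ fanBag j
  first∈ j = x∈p∪q⁺ (inj₁ (x∈⁅x⁆ _))

  second∈ : ∀ j → f (second j) ∈ fanBag j
  second∈ j = x∈p∪q⁺ (inj₂ (x∈p∪q⁺ (inj₁ (x∈⁅x⁆ _))))

  third∈ : ∀ j → f (third j) ∈ fanBag j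
  third∈ j = x∈p∪q⁺ (inj₂ (x∈p∪q⁺ (inj₂ (x∈⁅x⁆ _))))

  ∈fanBag⁻ : ∀ {v} j → v ∈ fanBag j → v ≡ f Fin.zero ⊎ v ≡ f (second j) ⊎ v ≡ f (third j)
  ∈fanBag⁻ j v∈ = Sum.map (x∈⁅y⁆⇒x≡y _) (Sum.map (x∈⁅y⁆⇒x≡y _) (x∈⁅y⁆⇒x≡y _) ∘ x∈p∪q⁻ _ _) (x∈p∪q⁻ _ _ v∈)

  ∣fanBag∣≤3 : ∀ j → ∣ fanBag j ∣ ≤ 3
  ∣fanBag∣≤3 j = begin
    ∣ fanBag j ∣                        ≤⟨ ∣p∪q∣≤∣p∣+∣q∣ ⁅ a ⁆ (⁅ b ⁆ ∪ ⁅ c ⁆) ⟩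
    ∣ ⁅ a ⁆ ∣ + ∣ ⁅ b ⁆ ∪ ⁅ c ⁆ ∣         ≤⟨ ℕ.+-monoʳ-≤ ∣ ⁅ a ⁆ ∣ (∣p∪q∣≤∣p∣+∣q∣ ⁅ b ⁆ ⁅ c ⁆) ⟩
    ∣ ⁅ a ⁆ ∣ + (∣ ⁅ b ⁆ ∣ + ∣ ⁅ c ⁆ ∣)   ≡⟨ cong₂ _+_ (∣⁅x⁆∣≡1 a) (cong₂ _+_ (∣⁅x⁆∣≡1 b) (∣⁅x⁆∣≡1 c)) ⟩
    3                                   ∎
    where
    open ℕ.≤-Reasoning
    a b c : Fin n
    a = f Fin.zero
    b = f (second j)
    c = f (third j)

  pathPointers : ParentPointers k
  pathPointers = record
    { parent = λ { Fin.zero → Fin.zero ; (Fin.suc j) → inject₁ j }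
    ; root = Fin.zero ; rank = toℕ ; parent-root = refl
    ; rank-parent = λ { Fin.zero 0≢0 → contradiction refl 0≢0
                      ; (Fin.suc j) _ → s≤s (ℕ.≤-reflexive (Fin.toℕ-inject₁ j)) } }

  open ParentPointers pathPointers using (parent)

  pathGraph : Graph (suc k)
  pathGraph = parentGraph parent

  path-adj : ∀ j j′ → toℕ j ≡ suc (toℕ j′) → Adj pathGraph j j′
  path-adj (Fin.suc j) j′ j≡j′+1 = parentGraph-adj parent
    (λ j≡j′ → ℕ.1+n≢n (trans (sym j≡j′+1) (cong toℕ j≡j′)))
    (Fin.toℕ-injective (trans (ℕ.suc-injective (sym j≡j′+1)) (sym (Fin.toℕ-inject₁ j))))

  fanTree : IsTree pathGraph
  fanTree = parentGraph-isTree pathPointers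

  in-fanBag : ∀ {i i′} j → toℕ i ≡ toℕ i′ → f i ∈ fanBag j → f i′ ∈ fanBag j
  in-fanBag j i≡i′ = subst (λ x → f x ∈ fanBag j) (Fin.toℕ-injective i≡i′)

  vertex-bag : ∀ i → ∃ λ j → f i ∈ fanBag j
  vertex-bag Fin.zero = Fin.zero , first∈ Fin.zero
  vertex-bag (Fin.suc i) with inject₁-or-fromℕ i
  ... | inj₁ (j , refl) = j , second∈ j
  ... | inj₂ refl = fromℕ k , third∈ (fromℕ k)

  edge-bag : ∀ i → ∃ λ j → f i ∈ fanBag j × f (next i) ∈ fanBag j
  edge-bag i with toℕ-next i
  ... | inj₂ (i≡last , next≡0) = fromℕ k ,
    in-fanBag (fromℕ k) (trans (cong (suc ∘ suc) (Fin.toℕ-fromℕ k)) (sym i≡last)) (third∈ (fromℕ k)) ,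
    in-fanBag (fromℕ k) (sym next≡0) (first∈ (fromℕ k))
  edge-bag Fin.zero | inj₁ (_ , next≡1) = Fin.zero , first∈ Fin.zero , in-fanBag Fin.zero (sym next≡1) (second∈ Fin.zero)
  edge-bag (Fin.suc i) | inj₁ (i<last , next≡i+1) with inject₁-or-fromℕ i
  ... | inj₁ (j , refl) = j , second∈ j ,
    in-fanBag j (trans (cong (suc ∘ suc) (sym (Fin.toℕ-inject₁ j))) (sym next≡i+1)) (third∈ j)
  ... | inj₂ refl = contradiction (subst (_< suc (suc k)) (cong (suc ∘ suc) (Fin.toℕ-fromℕ k)) i<last) (ℕ.<-irrefl refl)

  positions : ∀ {i} → i ≢ Fin.zero → ∀ j → f i ∈ fanBag j → toℕ i ≡ suc (toℕ j) ⊎ toℕ i ≡ suc (suc (toℕ j))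
  positions i≢0 j fi∈ with ∈fanBag⁻ j fi∈
  ... | inj₁ fi≡f0 = contradiction (f-inj fi≡f0) i≢0
  ... | inj₂ (inj₁ fi≡f2) = inj₁ (trans (cong toℕ (f-inj fi≡f2)) (cong suc (Fin.toℕ-inject₁ j)))
  ... | inj₂ (inj₂ fi≡f3) = inj₂ (cong toℕ (f-inj fi≡f3))

  -- f 0 lies in every bag, and any other cycle vertex in at most two consecutive ones.
  fan-connected : ∀ i → ConnectedSet pathGraph (λ j → f i ∈ fanBag j)
  fan-connected i {j} {j′} fi∈j fi∈j′ with i Fin.≟ Fin.zero
  ... | yes refl = mapʷ id (λ {x} _ → first∈ x) id (proj₁ (proj₂ fanTree) {j} {j′} ∈⊤ ∈⊤)
  ... | no i≢0 with positions i≢0 j fi∈j | positions i≢0 j′ fi∈j′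
  ...   | inj₁ e | inj₁ e′ = subst (Walk _ _ j) (Fin.toℕ-injective (ℕ.suc-injective (trans (sym e) e′))) ([] fi∈j)
  ...   | inj₂ e | inj₂ e′ = subst (Walk _ _ j) (Fin.toℕ-injective (ℕ.suc-injective (ℕ.suc-injective (trans (sym e) e′)))) ([] fi∈j)
  ...   | inj₁ e | inj₂ e′ = step fi∈j (path-adj j j′ (ℕ.suc-injective (trans (sym e) e′))) ([] fi∈j′)
  ...   | inj₂ e | inj₁ e′ = step fi∈j (Adj-sym {G = pathGraph} (path-adj j′ j (ℕ.suc-injective (trans (sym e′) e)))) ([] fi∈j′)

TWAtMost-cycle : ∀ {n} (H : Graph n) → IsCycleGraph H → TWAtMost H 2
TWAtMost-cycle H (k , f , f-inj , f∈V , f-onto , f-adj) = decomp , ∣fanBag∣≤3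
  where
  open Fan H f f-inj f∈V
  decomp : TreeDecomp H
  decomp = record
    { m = k ; T = pathGraph ; tree = fanTree ; bag = fanBag
    ; bag⊆V = λ j v∈ → [ (λ { refl → f∈V _ }) , [ (λ { refl → f∈V _ }) , (λ { refl → f∈V _ }) ] ] (∈fanBag⁻ j v∈)
    ; vertexCover = λ v v∈V → case f-onto v v∈V of λ { (i , refl) → vertex-bag i }
    ; vertexConnected = λ v v∈V → case f-onto v v∈V of λ { (i , refl) → fan-connected i }
    ; edgeCover = λ u v u~v → case f-onto u (proj₁ (proj₂ u~v)) , f-onto v (proj₁ (proj₂ (proj₂ u~v))) of λ
        { ((i , refl) , (i′ , refl)) → case Equivalence.to (f-adj i i′) u~v of λ
          { (inj₁ refl) → edge-bag i
          ; (inj₂ refl) → let (j , fi∈ , fi′∈) = edge-bag i′ in j , fi′∈ , fi∈ } }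
    }

-- Enlarging the index tree of a decomposition by leaves with empty bags

module Padding {n} {H : Graph n} (D : TreeDecomp H) {K} (m≤K : m D ≤ K) where

  embed : Fin (suc (m D)) → Fin (suc K)
  embed z = Fin.inject≤ z (s≤s m≤K)

  embed-injective : ∀ {z z′} → embed z ≡ embed z′ → z ≡ z′
  embed-injective = Fin.inject≤-injective _ _ _ _

  embedded? : ∀ y → (∃ λ z → embed z ≡ y) ⊎ (∀ z → embed z ≢ y)
  embedded? y with toℕ y ℕ.<? suc (m D)
  ... | yes y<m+1 = inj₁ (fromℕ< y<m+1 , Fin.toℕ-injective (trans (Fin.toℕ-inject≤ _ _) (Fin.toℕ-fromℕ< y<m+1)))
  ... | no y≮m+1 = inj₂ λ z z↦y → y≮m+1 (subst (_< suc (m D)) (trans (sym (Fin.toℕ-inject≤ z _)) (cong toℕ z↦y)) (Fin.toℕ<n z))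

  pad : ∀ {A : Set} → (Fin (suc (m D)) → A) → A → Fin (suc K) → A
  pad g default y = [ g ∘ proj₁ , (λ _ → default) ] (embedded? y)

  pad-embed : ∀ {A : Set} (g : Fin (suc (m D)) → A) default z → pad g default (embed z) ≡ g z
  pad-embed g default z with embedded? (embed z)
  ... | inj₁ (z′ , z′↦z) = cong g (embed-injective z′↦z)
  ... | inj₂ not-embedded = contradiction refl (not-embedded z)

  pad-padding : ∀ {A : Set} (g : Fin (suc (m D)) → A) default y → (∀ z → embed z ≢ y) → pad g default y ≡ default
  pad-padding g default y not-embedded with embedded? y
  ... | inj₁ (z , z↦y) = contradiction z↦y (not-embedded z)
  ... | inj₂ _ = refl

  open Rooting (T D) (tree D) Fin.zero using (parentPointers; adj⇒parent)
  open ParentPointers parentPointers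

  paddedParent : Fin (suc K) → Fin (suc K)
  paddedParent = pad (embed ∘ parent) (embed root)

  paddedRank : Fin (suc K) → ℕ
  paddedRank = pad rank (suc (rank root))

  paddedPointers : ParentPointers K
  paddedPointers = record
    { parent = paddedParent
    ; root = embed root
    ; rank = paddedRank
    ; parent-root = trans (pad-embed (embed ∘ parent) (embed root) root) (cong embed parent-root)
    ; rank-parent = λ y y≢root → rank-decreases y y≢root (embedded? y) }
    where
    rank-decreases : ∀ y → y ≢ embed root → (∃ λ z → embed z ≡ y) ⊎ (∀ z → embed z ≢ y) →
      paddedRank (paddedParent y) < paddedRank y
    rank-decreases _ z≢root (inj₁ (z , refl))
      rewrite pad-embed (embed ∘ parent) (embed root) z | pad-embed rank (suc (rank root)) (parent z)
            | pad-embed rank (suc (rank root)) z = rank-parent z (z≢root ∘ cong embed)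
    rank-decreases y _ (inj₂ not-embedded)
      rewrite pad-padding (embed ∘ parent) (embed root) y not-embedded | pad-embed rank (suc (rank root)) root
            | pad-padding rank (suc (rank root)) y not-embedded = ℕ.≤-refl

  paddedGraph : Graph (suc K)
  paddedGraph = parentGraph paddedParent

  embed-adj : ∀ {a b} → Adj (T D) a b → Adj paddedGraph (embed a) (embed b)
  embed-adj {a} {b} a~b@(a≢b , _) with adj⇒parent a~b
  ... | inj₁ b≡parent = parentGraph-adj paddedParent (a≢b ∘ embed-injective)
    (trans (cong embed b≡parent) (sym (pad-embed (embed ∘ parent) (embed root) a)))
  ... | inj₂ a≡parent = Adj-sym {G = paddedGraph} (parentGraph-adj paddedParent (a≢b ∘ sym ∘ embed-injective)
    (trans (cong embed a≡parent) (sym (pad-embed (embed ∘ parent) (embed root) b))))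

  paddedBag : Fin (suc K) → Subset n
  paddedBag = pad (bag D) ⊥

  ∈paddedBag⁻ : ∀ {v} y → v ∈ paddedBag y → ∃ λ z → embed z ≡ y × v ∈ bag D z
  ∈paddedBag⁻ y v∈ with embedded? y
  ... | inj₁ (z , z↦y) = z , z↦y , v∈
  ... | inj₂ _ = contradiction v∈ ∉⊥

  ∈paddedBag⁺ : ∀ {v z} → v ∈ bag D z → v ∈ paddedBag (embed z)
  ∈paddedBag⁺ {z = z} = subst (_ ∈_) (sym (pad-embed (bag D) ⊥ z))

  paddedDecomp : TreeDecomp H
  paddedDecomp = record
    { m = K ; T = paddedGraph ; tree = parentGraph-isTree paddedPointers ; bag = paddedBag
    ; bag⊆V = λ y v∈ → let (z , _ , v∈z) = ∈paddedBag⁻ y v∈ in bag⊆V D z v∈z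
    ; vertexCover = λ v v∈V → let (z , v∈z) = vertexCover D v v∈V in embed z , ∈paddedBag⁺ v∈z
    ; vertexConnected = connected
    ; edgeCover = λ u v u~v → let (z , u∈z , v∈z) = edgeCover D u v u~v in embed z , ∈paddedBag⁺ u∈z , ∈paddedBag⁺ v∈z
    }
    where
    connected : ∀ v → v ∈ V H → ConnectedSet paddedGraph (λ y → v ∈ paddedBag y)
    connected v v∈V {y} {y′} v∈y v∈y′ with ∈paddedBag⁻ y v∈y | ∈paddedBag⁻ y′ v∈y′
    ... | z , refl , v∈z | z′ , refl , v∈z′ = mapʷ embed ∈paddedBag⁺ embed-adj (vertexConnected D v v∈V v∈z v∈z′)

  paddedBag-size : ∀ {c} → (∀ z → ∣ bag D z ∣ ≤ c) → ∀ y → ∣ paddedBag y ∣ ≤ c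
  paddedBag-size ∣bag∣≤c y with embedded? y
  ... | inj₁ (z , _) = ∣bag∣≤c z
  ... | inj₂ _ = ℕ.≤-trans (ℕ.≤-reflexive (∣⊥∣≡0 n)) z≤n

-- Gluing decompositions of the torsos

module Gluing {n} (G : Graph n) (A : Subset n) (D : TreeDecomp G)
  (small-adhesion : ∀ s t → Adj (T D) s t → ∣ bag D s ∩ bag D t ∣ ≤ 2)
  {k} (torsoTW : ∀ t → TWAtMost (torso G D t [ A ]) k) where

  N : ℕ
  N = suc (m D)

  opaque
    K : ℕ
    K = maxᶠ (λ t → m (proj₁ (torsoTW t)))

    m≤K : ∀ t → m (proj₁ (torsoTW t)) ≤ K
    m≤K = f≤maxᶠ (λ t → m (proj₁ (torsoTW t)))

  -- Padding the blocks to a common size makes the nodes of the glued tree the pairs Fin N × Fin (suc K).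
  block : ∀ t → TreeDecomp (torso G D t [ A ])
  block t = Padding.paddedDecomp (proj₁ (torsoTW t)) (m≤K t)

  block-width : ∀ t z → ∣ bag (block t) z ∣ ≤ suc k
  block-width t = Padding.paddedBag-size (proj₁ (torsoTW t)) _ (proj₂ (torsoTW t))

  in-torso : ∀ {t v} → v ∈ bag D t → v ∈ A → v ∈ V (torso G D t [ A ])
  in-torso v∈t v∈A = x∈p∩q⁺ (v∈t , v∈A)

  -- An adhesion is a clique of the torso, so its part in A lies in a single bag of the torso's decomposition.
  adhesion-in-bag : ∀ {s t} → Adj (T D) s t → (E : TreeDecomp (torso G D s [ A ])) →
    ∃ λ z → (bag D s ∩ bag D t) ∩ A ⊆ bag E z
  adhesion-in-bag {s} {t} s~t E = clique-in-bag E ((bag D s ∩ bag D t) ∩ A)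
    (ℕ.≤-trans (∣p∩q∣≤∣p∣ (bag D s ∩ bag D t) A) (small-adhesion s t s~t)) (in-torso′ ∘ split) clique
    where
    split : ∀ {v} → v ∈ (bag D s ∩ bag D t) ∩ A → v ∈ bag D s × v ∈ bag D t × v ∈ A
    split v∈ = let (v∈st , v∈A) = x∈p∩q⁻ (bag D s ∩ bag D t) A v∈ ; (v∈s , v∈t) = x∈p∩q⁻ (bag D s) (bag D t) v∈st
               in v∈s , v∈t , v∈A
    in-torso′ : ∀ {v} → v ∈ bag D s × v ∈ bag D t × v ∈ A → v ∈ V (torso G D s [ A ])
    in-torso′ (v∈s , _ , v∈A) = in-torso v∈s v∈A
    clique : ∀ {u v} → u ∈ (bag D s ∩ bag D t) ∩ A → v ∈ (bag D s ∩ bag D t) ∩ A → u ≢ v → Adj (torso G D s [ A ]) u v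
    clique u∈ v∈ u≢v = let (u∈s , u∈t , u∈A) = split u∈ ; (v∈s , v∈t , v∈A) = split v∈
                       in u≢v , in-torso u∈s u∈A , in-torso v∈s v∈A , inj₁ (inj₂ (t , s~t , u∈t , v∈t))

  open Rooting (T D) (tree D) Fin.zero using ()
    renaming (parent to parentT; rank to rankT; parent-adj to parentT-adj; rank-parent to rankT-parent;
              adj⇒parent to adj⇒parentT; parent-adj⇒≢root to parentT-adj⇒≢root)

  separator : Fin N → Subset n
  separator t = (bag D t ∩ bag D (parentT t)) ∩ A

  opaque
    -- The bag of block t holding the separator towards the parent (junk at the root).
    anchor : Fin N → Fin (suc K)
    anchor t with t Fin.≟ Fin.zero
    ... | yes _ = Fin.zero
    ... | no t≢root = proj₁ (adhesion-in-bag (parentT-adj t t≢root) (block t))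

    separator⊆anchor : ∀ t → t ≢ Fin.zero → separator t ⊆ bag (block t) (anchor t)
    separator⊆anchor t t≢root′ with t Fin.≟ Fin.zero
    ... | yes t≡root = contradiction t≡root t≢root′
    ... | no t≢root = proj₂ (adhesion-in-bag (parentT-adj t t≢root) (block t))

    socket : Fin N → Fin (suc K)
    socket t with t Fin.≟ Fin.zero
    ... | yes _ = Fin.zero
    ... | no t≢root = proj₁ (adhesion-in-bag (Adj-sym {G = T D} (parentT-adj t t≢root)) (block (parentT t)))

    separator⊆socket : ∀ t → t ≢ Fin.zero → separator t ⊆ bag (block (parentT t)) (socket t)
    separator⊆socket t t≢root′ with t Fin.≟ Fin.zero
    ... | yes t≡root = contradiction t≡root t≢root′
    ... | no t≢root = proj₂ (adhesion-in-bag (Adj-sym {G = T D} (parentT-adj t t≢root)) (block (parentT t)))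
                      ∘ subst (_ ∈_) (cong (_∩ A) (∩-comm (bag D t) (bag D (parentT t))))

  module Block (t : Fin N) = Rooting (T (block t)) (tree (block t)) (anchor t)

  opaque
    R : ℕ
    R = maxᶠ (λ t → maxᶠ (Block.rank t))

    rankB≤R : ∀ t z → Block.rank t z ≤ R
    rankB≤R t z = ℕ.≤-trans (f≤maxᶠ (Block.rank t) z) (f≤maxᶠ (λ t → maxᶠ (Block.rank t)) t)

  Node : Set
  Node = Fin N × Fin (suc K)

  -- Within a block follow its own rooting; the anchor of block t hangs from the socket in block parentT t.
  parentN : Node → Node
  parentN (t , z) with z Fin.≟ anchor t | t Fin.≟ Fin.zero
  ... | no _ | _ = t , Block.parent t z
  ... | yes _ | yes _ = t , z
  ... | yes _ | no _ = parentT t , socket t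

  rankN : Node → ℕ
  rankN (t , z) = rankT t * suc R + Block.rank t z

  rootN : Node
  rootN = Fin.zero , anchor Fin.zero

  parentN-inner : ∀ t z → z ≢ anchor t → parentN (t , z) ≡ (t , Block.parent t z)
  parentN-inner t z z≢anchor with z Fin.≟ anchor t
  ... | yes z≡anchor = contradiction z≡anchor z≢anchor
  ... | no _ = refl

  parentN-anchor : ∀ t → t ≢ Fin.zero → parentN (t , anchor t) ≡ (parentT t , socket t)
  parentN-anchor t t≢root with anchor t Fin.≟ anchor t | t Fin.≟ Fin.zero
  ... | no anchor≢anchor | _ = contradiction refl anchor≢anchor
  ... | yes _ | yes t≡root = contradiction t≡root t≢root
  ... | yes _ | no _ = refl

  parentN-root : parentN rootN ≡ rootN
  parentN-root with anchor Fin.zero Fin.≟ anchor Fin.zero | Fin.zero {m D} Fin.≟ Fin.zero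
  ... | no anchor≢anchor | _ = contradiction refl anchor≢anchor
  ... | yes _ | no 0≢0 = contradiction refl 0≢0
  ... | yes _ | yes _ = refl

  rankN-parentN : ∀ p → p ≢ rootN → rankN (parentN p) < rankN p
  rankN-parentN (t , z) p≢root with z Fin.≟ anchor t | t Fin.≟ Fin.zero
  ... | no z≢anchor | _ = ℕ.+-monoʳ-< (rankT t * suc R) (Block.rank-parent t z z≢anchor)
  ... | yes refl | yes refl = contradiction refl p≢root
  ... | yes _ | no t≢root = *+-<-lex (rankT-parent t t≢root) (s≤s (rankB≤R (parentT t) (socket t)))

  M : ℕ
  M = K + m D * suc K

  node : Fin N → Fin (suc K) → Fin (suc M)
  node = Fin.combine

  decode : Fin (suc M) → Node
  decode = Fin.remQuot (suc K)

  decode-node : ∀ t z → decode (node t z) ≡ (t , z)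
  decode-node = Fin.remQuot-combine

  node-decode : ∀ a → uncurry node (decode a) ≡ a
  node-decode = Fin.combine-remQuot (suc K)

  gluedParent : Fin (suc M) → Fin (suc M)
  gluedParent = uncurry node ∘ parentN ∘ decode

  gluedPointers : ParentPointers M
  gluedPointers = record
    { parent = gluedParent
    ; root = uncurry node rootN
    ; rank = rankN ∘ decode
    ; parent-root = trans (cong (uncurry node ∘ parentN) (uncurry decode-node rootN)) (cong (uncurry node) parentN-root)
    ; rank-parent = λ a a≢root → subst (λ p → rankN p < rankN (decode a)) (sym (uncurry decode-node (parentN (decode a))))
        (rankN-parentN (decode a) (λ a↦root → a≢root (trans (sym (node-decode a)) (cong (uncurry node) a↦root))))
    }

  gluedTree : Graph (suc M)
  gluedTree = parentGraph gluedParent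

  link : ∀ {p q} → p ≢ q → q ≡ parentN p → Adj gluedTree (uncurry node p) (uncurry node q)
  link {p} p≢q q≡parent = parentGraph-adj gluedParent
    (λ p↦q → p≢q (trans (sym (uncurry decode-node p)) (trans (cong decode p↦q) (uncurry decode-node _))))
    (cong (uncurry node) (trans q≡parent (cong parentN (sym (uncurry decode-node p)))))

  block-parent-adj : ∀ t {a b} → Adj (T (block t)) a b → b ≡ Block.parent t a → Adj gluedTree (node t a) (node t b)
  block-parent-adj t {a} a~b@(a≢b , _) b≡parent = link (a≢b ∘ cong proj₂) (trans (cong (t ,_) b≡parent)
    (sym (parentN-inner t a (Block.parent-adj⇒≢root t (subst (Adj (T (block t)) a) b≡parent a~b)))))

  block-adj : ∀ t {a b} → Adj (T (block t)) a b → Adj gluedTree (node t a) (node t b)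
  block-adj t a~b with Block.adj⇒parent t a~b
  ... | inj₁ b≡parent = block-parent-adj t a~b b≡parent
  ... | inj₂ a≡parent = Adj-sym {G = gluedTree} (block-parent-adj t (Adj-sym {G = T (block t)} a~b) a≡parent)

  separator-adj : ∀ t → t ≢ Fin.zero → Adj gluedTree (node t (anchor t)) (node (parentT t) (socket t))
  separator-adj t t≢root = link (proj₁ (parentT-adj t t≢root) ∘ cong proj₁) (sym (parentN-anchor t t≢root))

  gluedBag : Fin (suc M) → Subset n
  gluedBag = uncurry (bag ∘ block) ∘ decode

  ∈gluedBag⁺ : ∀ {v} t z → v ∈ bag (block t) z → v ∈ gluedBag (node t z)
  ∈gluedBag⁺ t z = subst (_ ∈_) (sym (cong (uncurry (bag ∘ block)) (decode-node t z)))

  ∈gluedBag⁻ : ∀ {v} a → v ∈ gluedBag a → v ∈ bag D (proj₁ (decode a)) × v ∈ A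
  ∈gluedBag⁻ a = x∈p∩q⁻ (bag D (proj₁ (decode a))) A ∘ bag⊆V (block (proj₁ (decode a))) (proj₂ (decode a))

  module _ (v : Fin n) (v∈A : v ∈ A) where

    Holds : Fin (suc M) → Set
    Holds a = v ∈ gluedBag a

    walk-in-block : ∀ t {z z′} → v ∈ bag D t → v ∈ bag (block t) z → v ∈ bag (block t) z′ →
      Walk gluedTree Holds (node t z) (node t z′)
    walk-in-block t v∈t v∈z v∈z′ = mapʷ (node t) (λ {z} → ∈gluedBag⁺ t z) (block-adj t) (vertexConnected (block t) v (in-torso v∈t v∈A) v∈z v∈z′)

    -- Follow a walk of D, crossing between neighbouring blocks through the bags holding their separator.
    walk-along : ∀ {t t′} → Walk (T D) (λ s → v ∈ bag D s) t t′ → ∀ {z z′} →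
      v ∈ bag (block t) z → v ∈ bag (block t′) z′ → Walk gluedTree Holds (node t z) (node t′ z′)
    walk-along ([] v∈t) v∈z v∈z′ = walk-in-block _ v∈t v∈z v∈z′
    walk-along (step {t} {s} v∈t t~s rest) v∈z v∈z′ with adj⇒parentT t~s
    ... | inj₁ refl = walk-in-block t v∈t v∈z (separator⊆anchor t t≢root v∈sep) ++ʷ
        step (∈gluedBag⁺ t (anchor t) (separator⊆anchor t t≢root v∈sep)) (separator-adj t t≢root)
          (walk-along rest (separator⊆socket t t≢root v∈sep) v∈z′)
      where
      t≢root : t ≢ Fin.zero
      t≢root = parentT-adj⇒≢root t~s
      v∈sep : v ∈ separator t
      v∈sep = x∈p∩q⁺ (x∈p∩q⁺ (v∈t , walk-source rest) , v∈A)
    ... | inj₂ refl = walk-in-block _ v∈t v∈z (separator⊆socket s s≢root v∈sep) ++ʷ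
        step (∈gluedBag⁺ (parentT s) (socket s) (separator⊆socket s s≢root v∈sep)) (Adj-sym {G = gluedTree} (separator-adj s s≢root))
          (walk-along rest (separator⊆anchor s s≢root v∈sep) v∈z′)
      where
      s≢root : s ≢ Fin.zero
      s≢root = parentT-adj⇒≢root (Adj-sym {G = T D} t~s)
      v∈sep : v ∈ separator s
      v∈sep = x∈p∩q⁺ (x∈p∩q⁺ (walk-source rest , v∈t) , v∈A)

  gluedDecomp : TreeDecomp (G [ A ])
  gluedDecomp = record
    { m = M ; T = gluedTree ; tree = parentGraph-isTree gluedPointers ; bag = gluedBag
    ; bag⊆V = λ a v∈ → let (v∈t , v∈A) = ∈gluedBag⁻ a v∈ in x∈p∩q⁺ (bag⊆V D _ v∈t , v∈A)
    ; vertexCover = cover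
    ; vertexConnected = connected
    ; edgeCover = edge-cover
    }
    where
    cover : ∀ v → v ∈ V (G [ A ]) → ∃ λ a → v ∈ gluedBag a
    cover v v∈ = let (v∈V , v∈A) = x∈p∩q⁻ (V G) A v∈ ; (t , v∈t) = vertexCover D v v∈V
                     (z , v∈z) = vertexCover (block t) v (in-torso v∈t v∈A)
                 in node t z , ∈gluedBag⁺ t z v∈z

    connected : ∀ v → v ∈ V (G [ A ]) → ConnectedSet gluedTree (λ a → v ∈ gluedBag a)
    connected v v∈ {a} {a′} v∈a v∈a′ = subst₂ (Walk gluedTree _) (node-decode a) (node-decode a′)
      (walk-along v v∈A (vertexConnected D v v∈V (proj₁ (∈gluedBag⁻ a v∈a)) (proj₁ (∈gluedBag⁻ a′ v∈a′))) v∈a v∈a′)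
      where
      v∈V : v ∈ V G
      v∈V = proj₁ (x∈p∩q⁻ (V G) A v∈)
      v∈A : v ∈ A
      v∈A = proj₂ (x∈p∩q⁻ (V G) A v∈)

    edge-cover : ∀ u v → Adj (G [ A ]) u v → ∃ λ a → u ∈ gluedBag a × v ∈ gluedBag a
    edge-cover u v (u≢v , u∈ , v∈ , e) =
      let (u∈V , u∈A) = x∈p∩q⁻ (V G) A u∈ ; (v∈V , v∈A) = x∈p∩q⁻ (V G) A v∈
          (t , u∈t , v∈t) = edgeCover D u v (u≢v , u∈V , v∈V , e)
          (z , u∈z , v∈z) = edgeCover (block t) u v (u≢v , in-torso u∈t u∈A , in-torso v∈t v∈A , Sum.map inj₁ inj₁ e)
      in node t z , ∈gluedBag⁺ t z u∈z , ∈gluedBag⁺ t z v∈z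

  glued-TWAtMost : TWAtMost (G [ A ]) k
  glued-TWAtMost = gluedDecomp , λ a → block-width (proj₁ (decode a)) (proj₂ (decode a))

lemma3p2 : ∀ {n} (G : Graph n) (A : Subset n) → A ⊆ V G → (w : ℕ)
    → (D : TreeDecomp G) → IsTutteDecomp G D
    → (∀ t → ThreeConnected (torso G D t) → TWAtMost (torso G D t [ A ]) w)
    → TWAtMost (G [ A ]) (w ⊔ 2)
lemma3p2 G A _ w D (small-adhesion , torso-kinds , _) torso-hyp = Gluing.glued-TWAtMost G A D small-adhesion torsoTW
  where
  torsoTW : ∀ t → TWAtMost (torso G D t [ A ]) (w ⊔ 2)
  torsoTW t with torso-kinds t
  ... | inj₁ 3-connected = TWAtMost-mono (ℕ.m≤m⊔n w 2) (torso-hyp t 3-connected)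
  ... | inj₂ (inj₁ cycle) = TWAtMost-mono (ℕ.m≤n⊔m w 2) (TWAtMost-induced A (TWAtMost-cycle (torso G D t) cycle))
  ... | inj₂ (inj₂ ∣bag∣≤2) = TWAtMost-small (torso G D t [ A ])
    (ℕ.≤-trans (∣p∩q∣≤∣p∣ (bag D t) A) (ℕ.≤-trans ∣bag∣≤2 (ℕ.≤-trans (ℕ.m≤n⊔m w 2) (ℕ.n≤1+n _))))
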